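{- Let $(A,B)$ be an instance of 3-Partition and let $\Phi(A,B)=(S,\mathrm{val},\mathcal{E},C)$ be the OCP instance constructed from it as described in the context. In any ordered covering $\mathcal{E}'=(E'_1,\dots,E'_k)$ of $\Phi(A,B)$ with $F(\mathcal{E}')\le C$, every assignment edge $E_{ij}$ that appears in $\mathcal{E}'$ with nonempty residual set $U(E_{ij})$ is preceded in the sequence by its opening edge $A_{ij}$.
   Context: OCP: an instance consists of a finite label set $S$, a family $\mathcal{E}$ of finite sets with $S\subseteq\bigcup\mathcal{E}$, a weight function $\mathrm{val}$ assigning a positive integer to every element of $\bigcup\mathcal{E}$, and a budget $C\in\mathbb{N}$. An ordered covering is a tuple $\mathcal{E}'=(E'_1,\dots,E'_k)$ of members of $\mathcal{E}$ with $S\subseteq\bigcup_i E'_i$; its residual sets are $U_i=E'_i\setminus\bigcup_{j<i}E'_j$ (written $U(E'_i)$), residual weights $u_i=\sum_{x\in U_i}\mathrm{val}(x)$, partial costs $f(E'_i)=2^{u_i}$ if $u_i>0$ and $0$ if $u_i=0$, and total cost $F(\mathcal{E}')=\sum_i f(E'_i)$. 3-Partition: an instance is a multiset $A=\{a_1,\dots,a_{3m}\}$ of positive integers and a positive integer $B$ with $\sum_{i=1}^{3m}a_i=mB$ and $B/4<a_i<B/2$ for all $i$. The construction $\Phi(A,B)$: let $S=\{\alpha_1,\dots,\alpha_{3m}\}$ with $\mathrm{val}(\alpha_\ell)=a_\ell$ (distinct labels even for repeated values). Let $T$ be the collection of all 3-element subsets $X\subseteq S$ with $\sum_{\alpha\in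 X}\mathrm{val}(\alpha)=B$, enumerated as $X_1,\dots,X_{|T|}$. Set $t=1$ and $w=t+B+\lceil\log_2 m\rceil+1$. For each $i\in\{1,\dots,m\}$ and $j\in\{1,\dots,|T|\}$ introduce two new distinct elements $\omega_{ij},\tau_{ij}\notin S$ (all distinct across pairs $(i,j)$) with $\mathrm{val}(\omega_{ij})=w$ and $\mathrm{val}(\tau_{ij})=t$, and define the opening edge $A_{ij}=\{\omega_{ij}\}$ and the assignment edge $E_{ij}=X_j\cup\{\omega_{ij},\tau_{ij}\}$. Let $\mathcal{E}=\{A_{ij},E_{ij}: i\in\{1,\dots,m\}, j\in\{1,\dots,|T|\}\}$ and $C=m(2^w+2^{t+B})$. -}

module Defs where

open import Data.Nat using (ℕ; zero; suc; _+_; _*_; _^_; _<_)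
open import Data.Nat.Logarithm using (⌈log₂_⌉)
open import Data.Bool using (Bool; true; false; if_then_else_; _∧_; not; T)
open import Data.Fin using (Fin; toℕ; _≟_)
open import Data.Fin.Subset using (Subset; ∣_∣)
open import Data.Vec using (lookup)
open import Data.List using (List; []; _∷_; _++_; map; allFin; concatMap; length; take)
open import Data.Nat.ListAction using (sum)
open import Data.Bool.ListAction using (any)
import Data.List as L
open import Data.Product using (Σ; _×_)
open import Relation.Binary.PropositionalEquality using (_≡_)
open import Relation.Nullary.Decidable using (⌊_⌋)

-- 3-Partition instances
-- A multiset A = {a_1,…,a_{3m}} is given as a function a : Fin (3 * m) → ℕ.

sumFin : ∀ {N} → (Fin N → ℕ) → ℕ
sumFin {N} f = sum (map f (allFin N))

record Is3Partition (m : ℕ) (a : Fin (3 * m) → ℕ) (B : ℕ) : Set where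
  field
    a-pos   : ∀ ℓ → 0 < a ℓ
    B-pos   : 0 < B
    a-sum   : sumFin a ≡ m * B
    a-lower : ∀ ℓ → B < 4 * a ℓ
    a-upper : ∀ ℓ → 2 * a ℓ < B

subsetWeight : ∀ {N} → (Fin N → ℕ) → Subset N → ℕ
subsetWeight a s = sumFin (λ ℓ → if lookup s ℓ then a ℓ else 0)

record IsEnumT (m : ℕ) (a : Fin (3 * m) → ℕ) (B : ℕ) (n : ℕ)
               (X : Fin n → Subset (3 * m)) : Set where
  field
    X-card   : ∀ j → ∣ X j ∣ ≡ 3
    X-weight : ∀ j → subsetWeight a (X j) ≡ B
    X-inj    : ∀ j j′ → X j ≡ X j′ → j ≡ j′
    X-surj   : ∀ s → ∣ s ∣ ≡ 3 → subsetWeight a s ≡ B → Σ (Fin n) (λ j → X j ≡ s)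

data Elem (m n : ℕ) : Set where
  α : Fin (3 * m) → Elem m n
  ω : Fin m → Fin n → Elem m n
  τ : Fin m → Fin n → Elem m n

data Edge (m n : ℕ) : Set where
  opening : Fin m → Fin n → Edge m n
  assign  : Fin m → Fin n → Edge m n

allElems : ∀ m n → List (Elem m n)
allElems m n = map α (allFin (3 * m))
  ++ concatMap (λ i → concatMap (λ j → ω i j ∷ τ i j ∷ []) (allFin n)) (allFin m)

module Construction (m : ℕ) (a : Fin (3 * m) → ℕ) (B : ℕ) (n : ℕ)
                    (X : Fin n → Subset (3 * m)) where

  t : ℕ
  t = 1

  w : ℕ
  w = t + B + ⌈log₂ m ⌉ + 1

  val : Elem m n → ℕ
  val (α ℓ)   = a ℓ
  val (ω i j) = w
  val (τ i j) = t

  -- membership of an element in an edge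
  --   A_ij = {ω_ij},   E_ij = X_j ∪ {ω_ij, τ_ij}
  _∈ᵉ_ : Elem m n → Edge m n → Bool
  α ℓ     ∈ᵉ opening i j = false
  ω i′ j′ ∈ᵉ opening i j = ⌊ i′ ≟ i ⌋ ∧ ⌊ j′ ≟ j ⌋
  τ i′ j′ ∈ᵉ opening i j = false
  α ℓ     ∈ᵉ assign i j  = lookup (X j) ℓ
  ω i′ j′ ∈ᵉ assign i j  = ⌊ i′ ≟ i ⌋ ∧ ⌊ j′ ≟ j ⌋
  τ i′ j′ ∈ᵉ assign i j  = ⌊ i′ ≟ i ⌋ ∧ ⌊ j′ ≟ j ⌋

  budget : ℕ
  budget = m * (2 ^ w + 2 ^ (t + B))

  IsCovering : List (Edge m n) → Set
  IsCovering E′ = ∀ ℓ → T (any (λ e → α ℓ ∈ᵉ e) E′)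

  inResidual : List (Edge m n) → Edge m n → Elem m n → Bool
  inResidual prev e x = (x ∈ᵉ e) ∧ not (any (λ e′ → x ∈ᵉ e′) prev)

  resWeight : List (Edge m n) → Edge m n → ℕ
  resWeight prev e = sum (map (λ x → if inResidual prev e x then val x else 0) (allElems m n))

  partialCost : ℕ → ℕ
  partialCost zero    = 0
  partialCost (suc u) = 2 ^ suc u

  at : (E′ : List (Edge m n)) → Fin (length E′) → Edge m n
  at E′ p = L.lookup E′ p

  before : (E′ : List (Edge m n)) → Fin (length E′) → List (Edge m n)
  before E′ p = take (toℕ p) E′

  totalCost : List (Edge m n) → ℕ
  totalCost E′ = sumFin (λ p → partialCost (resWeight (before E′ p) (at E′ p)))

{-# OPTIONS --safe #-}
module Submission where

-- Let x be residual for E_ij at position p. If ω_ij is covered before p, it is covered by A_ij: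
-- the only other edge containing ω_ij is E_ij itself, which would already have covered x.
-- Otherwise the covering is too expensive. The residual sets of an ordered covering partition
-- the covered elements; a residual carries α-weight only if it contains some τ_ij (the edge is
-- E_ij, seen for the first time), and then at most B of it. As the α-weights total mB, at least
-- m of the τ's, hence at least m of the ω's, get covered. A residual with k of the ω's costs at
-- least 2^(kw) ≥ k·2^w, and the one at p, which also contains τ_ij, at least (k+1)·2^w.
-- So F ≥ (m+1)·2^w > m(2^w + 2^(t+B)) = C, because m ≤ 2^⌈log₂ m⌉ makes m·2^(t+B) < 2^w.

open import Defs

open import Algebra.Properties.CommutativeSemigroup using (interchange; xy∙z≈xz∙y; xy∙z≈y∙xz)
open import Data.Bool using (Bool; T; true; false; _∧_; _∨_; not; if_then_else_)
open import Data.Bool.ListAction using (any)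
open import Data.Bool.Properties using (T-∧; T-≡; ∨-identityʳ; ∨-assoc)
open import Data.Empty using (⊥-elim)
open import Data.Fin using (Fin; zero; suc; toℕ; _≟_)
open import Data.Fin.Subset using (Subset)
open import Data.List using (List; []; _∷_; _++_; _∷ʳ_; length; map; allFin; concatMap; take; lookup)
open import Data.List.Membership.Propositional using (_∈_; lose)
open import Data.List.Membership.Propositional.Properties using (∈-allFin; ∈-++⁺ʳ; ∈-concatMap⁺)
open import Data.List.Properties using (map-tabulate; ++-assoc; ++-identityʳ)
open import Data.List.Relation.Unary.Any as Any using (Any; here; there)
open import Data.List.Relation.Unary.Any.Properties using (any⁺; any⁻)
open import Data.Nat using (ℕ; zero; suc; _+_; _*_; _^_; _∸_; _≤_; _<_; z≤n; s≤s; ⌈_/2⌉; ⌊_/2⌋; >-nonZero)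
open import Data.Nat.Induction using (<-rec)
open import Data.Nat.ListAction using (sum)
open import Data.Nat.Logarithm using (⌈log₂_⌉; ⌈log₂⌉-mono-≤; ⌈log₂⌈n/2⌉⌉≡⌈log₂n⌉∸1)
open import Data.Nat.Properties hiding (_≟_)
open import Data.Product using (Σ; _×_; _,_; proj₁; proj₂)
open import Data.Sum using (_⊎_; inj₁; inj₂)
open import Data.Unit using (tt)
import Data.Vec as Vec
open import Function using (_∘_; id; case_of_)
open import Function.Bundles using (Equivalence)
open import Relation.Binary.PropositionalEquality using (_≡_; refl; sym; trans; cong; cong₂; subst; module ≡-Reasoning)
open import Relation.Nullary using (¬_; yes; no; contradiction)
open import Relation.Nullary.Decidable using (⌊_⌋; T?; toWitness; fromWitness)

open Equivalence using (to; from)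

module _ {A : Set} where

  ∑ : List A → (A → ℕ) → ℕ
  ∑ xs f = sum (map f xs)

  ∑-cong : ∀ xs {f g : A → ℕ} → (∀ x → f x ≡ g x) → ∑ xs f ≡ ∑ xs g
  ∑-cong []       f≡g = refl
  ∑-cong (x ∷ xs) f≡g = cong₂ _+_ (f≡g x) (∑-cong xs f≡g)

  ∑-mono-≤ : ∀ xs {f g : A → ℕ} → (∀ x → f x ≤ g x) → ∑ xs f ≤ ∑ xs g
  ∑-mono-≤ []       f≤g = z≤n
  ∑-mono-≤ (x ∷ xs) f≤g = +-mono-≤ (f≤g x) (∑-mono-≤ xs f≤g)

  ∑-zero : ∀ xs → ∑ xs (λ _ → 0) ≡ 0
  ∑-zero []       = refl
  ∑-zero (x ∷ xs) = ∑-zero xs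

  ∑-+ : ∀ xs (f g : A → ℕ) → ∑ xs (λ x → f x + g x) ≡ ∑ xs f + ∑ xs g
  ∑-+ []       f g = refl
  ∑-+ (x ∷ xs) f g = trans (cong (f x + g x +_) (∑-+ xs f g))
                           (interchange +-commutativeSemigroup (f x) (g x) (∑ xs f) (∑ xs g))

  ∑-* : ∀ xs c (f : A → ℕ) → ∑ xs (λ x → c * f x) ≡ c * ∑ xs f
  ∑-* []       c f = sym (*-zeroʳ c)
  ∑-* (x ∷ xs) c f = trans (cong (c * f x +_) (∑-* xs c f)) (sym (*-distribˡ-+ c (f x) (∑ xs f)))

  ∑-++ : ∀ xs ys (f : A → ℕ) → ∑ (xs ++ ys) f ≡ ∑ xs f + ∑ ys f
  ∑-++ []       ys f = refl
  ∑-++ (x ∷ xs) ys f = trans (cong (f x +_) (∑-++ xs ys f)) (sym (+-assoc (f x) (∑ xs f) (∑ ys f)))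

  ∈⇒≤∑ : ∀ {xs x} (f : A → ℕ) → x ∈ xs → f x ≤ ∑ xs f
  ∈⇒≤∑ {y ∷ xs} f (here refl) = m≤m+n (f y) (∑ xs f)
  ∈⇒≤∑ {y ∷ xs} f (there x∈) = ≤-trans (∈⇒≤∑ f x∈) (m≤n+m (∑ xs f) (f y))

  ∑-mono-≤-gap : ∀ {xs y c} {f g : A → ℕ} → (∀ x → f x ≤ g x) → y ∈ xs → f y + c ≤ g y →
                 ∑ xs f + c ≤ ∑ xs g
  ∑-mono-≤-gap {x ∷ xs} {c = c} {f} {g} f≤g (here refl) gap = begin
    f x + ∑ xs f + c  ≡⟨ xy∙z≈xz∙y +-commutativeSemigroup (f x) (∑ xs f) c ⟩
    f x + c + ∑ xs f  ≤⟨ +-mono-≤ gap (∑-mono-≤ xs f≤g) ⟩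
    g x + ∑ xs g      ∎
    where open ≤-Reasoning
  ∑-mono-≤-gap {x ∷ xs} {c = c} {f} {g} f≤g (there y∈) gap = begin
    f x + ∑ xs f + c    ≡⟨ +-assoc (f x) (∑ xs f) c ⟩
    f x + (∑ xs f + c)  ≤⟨ +-mono-≤ (f≤g x) (∑-mono-≤-gap f≤g y∈ gap) ⟩
    g x + ∑ xs g        ∎
    where open ≤-Reasoning

∑-map : ∀ {A B : Set} (h : A → B) xs (f : B → ℕ) → ∑ (map h xs) f ≡ ∑ xs (f ∘ h)
∑-map h []       f = refl
∑-map h (x ∷ xs) f = cong (f (h x) +_) (∑-map h xs f)

∑-concatMap : ∀ {A B : Set} (h : A → List B) xs (f : B → ℕ) →
              ∑ (concatMap h xs) f ≡ ∑ xs (λ x → ∑ (h x) f)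
∑-concatMap h []       f = refl
∑-concatMap h (x ∷ xs) f = trans (∑-++ (h x) (concatMap h xs) f) (cong (∑ (h x) f +_) (∑-concatMap h xs f))

∑-allFin-suc : ∀ {N} (f : Fin (suc N) → ℕ) → ∑ (allFin (suc N)) f ≡ f zero + ∑ (allFin N) (f ∘ suc)
∑-allFin-suc f = cong (f zero +_) (cong sum (trans (map-tabulate suc f) (sym (map-tabulate id (f ∘ suc)))))

module _ {A : Set} {P : A → Set} where

  Any-take⁻ : ∀ (xs : List A) k → Any P (take k xs) →
              Σ (Fin (length xs)) (λ q → toℕ q < k × P (lookup xs q))
  Any-take⁻ (x ∷ xs) (suc k) (here px)  = zero , s≤s z≤n , px
  Any-take⁻ (x ∷ xs) (suc k) (there pxs) with Any-take⁻ xs k pxs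
  ... | q , q<k , pq = suc q , s≤s q<k , pq

  Any-take⁺ : ∀ (xs : List A) {k} (q : Fin (length xs)) → toℕ q < k → P (lookup xs q) →
              Any P (take k xs)
  Any-take⁺ (x ∷ xs) {suc k} zero    _         px = here px
  Any-take⁺ (x ∷ xs) {suc k} (suc q) (s≤s q<k) px = there (Any-take⁺ xs q q<k px)

n<2^n : ∀ n → n < 2 ^ n
n<2^n zero    = s≤s z≤n
n<2^n (suc n) = +-mono-≤ (m^n>0 2 n) (≤-trans (n<2^n n) (m≤m+n (2 ^ n) 0))

2^m*n≤2^[n*m] : ∀ {m} → 0 < m → ∀ n → 2 ^ m * n ≤ 2 ^ (n * m)
2^m*n≤2^[n*m] {m} m>0 zero    = ≤-trans (≤-reflexive (*-zeroʳ (2 ^ m))) z≤n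
2^m*n≤2^[n*m] {m} m>0 (suc n) = begin
  2 ^ m * suc n          ≤⟨ *-monoʳ-≤ (2 ^ m) (≤-trans (n<2^n n) (^-monoʳ-≤ 2 n≤n*m)) ⟩
  2 ^ m * 2 ^ (n * m)    ≡⟨ ^-distribˡ-+-* 2 m (n * m) ⟨
  2 ^ (m + n * m)        ∎
  where
  open ≤-Reasoning
  n≤n*m : n ≤ n * m
  n≤n*m = m≤m*n n m {{>-nonZero m>0}}

n≤2^⌈log₂n⌉ : ∀ n → n ≤ 2 ^ ⌈log₂ n ⌉
n≤2^⌈log₂n⌉ = <-rec (λ n → n ≤ 2 ^ ⌈log₂ n ⌉) bound
  where
  bound : ∀ n → (∀ {k} → k < n → k ≤ 2 ^ ⌈log₂ k ⌉) → n ≤ 2 ^ ⌈log₂ n ⌉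
  bound zero          _   = z≤n
  bound (suc zero)    _   = s≤s z≤n
  bound n@(suc (suc k)) rec = begin
    n                      ≡⟨ ⌊n/2⌋+⌈n/2⌉≡n n ⟨
    ⌊ n /2⌋ + ⌈ n /2⌉      ≤⟨ +-monoˡ-≤ ⌈ n /2⌉ (⌊n/2⌋≤⌈n/2⌉ n) ⟩
    ⌈ n /2⌉ + ⌈ n /2⌉      ≤⟨ +-mono-≤ half half ⟩
    2 ^ L∸1 + 2 ^ L∸1      ≡⟨ cong (2 ^ L∸1 +_) (+-identityʳ (2 ^ L∸1)) ⟨
    2 ^ suc L∸1            ≡⟨ cong (2 ^_) (m+[n∸m]≡n (⌈log₂⌉-mono-≤ {2} {n} (s≤s (s≤s z≤n)))) ⟩
    2 ^ ⌈log₂ n ⌉          ∎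
    where
    open ≤-Reasoning
    L∸1 = ⌈log₂ n ⌉ ∸ 1
    half : ⌈ n /2⌉ ≤ 2 ^ L∸1
    half = subst (λ l → ⌈ n /2⌉ ≤ 2 ^ l) (⌈log₂⌈n/2⌉⌉≡⌈log₂n⌉∸1 n) (rec (⌈n/2⌉<n k))

if-∧-not+if≡if-∨ : ∀ b c (k : ℕ) →
                   (if b ∧ not c then k else 0) + (if c then k else 0) ≡ (if c ∨ b then k else 0)
if-∧-not+if≡if-∨ true  true  k = refl
if-∧-not+if≡if-∨ true  false k = +-identityʳ k
if-∧-not+if≡if-∨ false true  k = refl
if-∧-not+if≡if-∨ false false k = refl

-- Instantiated with Construction's _∈ᵉ_ and allElems, isNew is inResidual and
-- residualSum val is resWeight, both definitionally.
module Residuals {X E : Set} (_∈ₑ_ : X → E → Bool) (xs : List X) where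

  coveredBy : List E → X → Bool
  coveredBy L x = any (x ∈ₑ_) L

  isNew : List E → E → X → Bool
  isNew prev e x = (x ∈ₑ e) ∧ not (coveredBy prev x)

  residualSum : (X → ℕ) → List E → E → ℕ
  residualSum f prev e = ∑ xs (λ x → if isNew prev e x then f x else 0)

  coveredSum : (X → ℕ) → List E → ℕ
  coveredSum f L = ∑ xs (λ x → if coveredBy L x then f x else 0)

  isNew⁺ : ∀ prev e x → T (x ∈ₑ e) → ¬ T (coveredBy prev x) → T (isNew prev e x)
  isNew⁺ prev e x x∈e fresh with coveredBy prev x
  ... | true  = ⊥-elim (fresh tt)
  ... | false = from T-∧ (x∈e , tt)

  isNew⇒∈ : ∀ prev e x → T (isNew prev e x) → T (x ∈ₑ e)
  isNew⇒∈ prev e x new = proj₁ (to T-∧ new)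

  isNew⇒¬covered : ∀ prev e x → T (isNew prev e x) → ¬ T (coveredBy prev x)
  isNew⇒¬covered prev e x new with coveredBy prev x | proj₂ (to (T-∧ {x ∈ₑ e}) new)
  ... | false | _ = λ ()

  coveredBy-mono : ∀ L y x → (∀ e → T (y ∈ₑ e) → T (x ∈ₑ e)) →
                   T (coveredBy L y) → T (coveredBy L x)
  coveredBy-mono L y x y⇒x = any⁺ _ ∘ Any.map (λ {e} → y⇒x e) ∘ any⁻ _ L

  coveredBy-take⁻ : ∀ L k x → T (coveredBy (take k L) x) →
                    Σ (Fin (length L)) (λ q → toℕ q < k × T (x ∈ₑ lookup L q))
  coveredBy-take⁻ L k x = Any-take⁻ L k ∘ any⁻ _ (take k L)

  coveredBy-take⁺ : ∀ L {k} x (q : Fin (length L)) → toℕ q < k → T (x ∈ₑ lookup L q) →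
                    T (coveredBy (take k L) x)
  coveredBy-take⁺ L x q q<k x∈ = any⁺ _ (Any-take⁺ L q q<k x∈)

  coveredBy-∷ʳ : ∀ prev e x → coveredBy (prev ∷ʳ e) x ≡ coveredBy prev x ∨ (x ∈ₑ e)
  coveredBy-∷ʳ []          e x = ∨-identityʳ (x ∈ₑ e)
  coveredBy-∷ʳ (e′ ∷ prev) e x =
    trans (cong ((x ∈ₑ e′) ∨_) (coveredBy-∷ʳ prev e x)) (sym (∨-assoc (x ∈ₑ e′) _ _))

  new⇒≤residualSum : ∀ f prev e {x} → x ∈ xs → T (isNew prev e x) → f x ≤ residualSum f prev e
  new⇒≤residualSum f prev e {x} x∈xs new = subst (_≤ residualSum f prev e) f-at-x
    (∈⇒≤∑ (λ y → if isNew prev e y then f y else 0) x∈xs)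
    where
    f-at-x : (if isNew prev e x then f x else 0) ≡ f x
    f-at-x rewrite to T-≡ new = refl

  residualSum-≤-∑ : ∀ f g prev e → (∀ x → T (isNew prev e x) → f x ≤ g x) →
                    residualSum f prev e ≤ ∑ xs g
  residualSum-≤-∑ f g prev e f≤g = ∑-mono-≤ xs masked≤g
    where
    masked≤g : ∀ x → (if isNew prev e x then f x else 0) ≤ g x
    masked≤g x with isNew prev e x | f≤g x
    ... | true  | fx≤gx = fx≤gx tt
    ... | false | _     = z≤n

  residualSum-≡0 : ∀ f prev e → (∀ x → T (isNew prev e x) → f x ≡ 0) → residualSum f prev e ≡ 0
  residualSum-≡0 f prev e f≡0 = n≤0⇒n≡0 (≤-trans
    (residualSum-≤-∑ f (λ _ → 0) prev e (λ x new → ≤-reflexive (f≡0 x new))) (≤-reflexive (∑-zero xs)))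

  residualSum-affine-≤ : ∀ {c f g h} → (∀ x → f x * c + g x ≤ h x) →
                         ∀ prev e → residualSum f prev e * c + residualSum g prev e ≤ residualSum h prev e
  residualSum-affine-≤ {c} {f} {g} {h} fc+g≤h prev e = begin
    R f * c + R g                                     ≡⟨ cong (_+ R g) (*-comm (R f) c) ⟩
    c * R f + R g                                     ≡⟨ cong (_+ R g) (∑-* xs c (masked f)) ⟨
    ∑ xs (λ x → c * masked f x) + R g                 ≡⟨ ∑-+ xs (λ x → c * masked f x) (masked g) ⟨
    ∑ xs (λ x → c * masked f x + masked g x)          ≤⟨ ∑-mono-≤ xs pointwise ⟩
    R h                                               ∎
    where
    open ≤-Reasoning
    masked : (X → ℕ) → X → ℕ
    masked k x = if isNew prev e x then k x else 0
    R : (X → ℕ) → ℕ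
    R k = residualSum k prev e
    pointwise : ∀ x → c * masked f x + masked g x ≤ masked h x
    pointwise x with isNew prev e x
    ... | true  = subst (_≤ h x) (cong (_+ g x) (*-comm (f x) c)) (fc+g≤h x)
    ... | false = ≤-reflexive (trans (+-identityʳ (c * 0)) (*-zeroʳ c))

  coveredSum-∷ʳ : ∀ f prev e → residualSum f prev e + coveredSum f prev ≡ coveredSum f (prev ∷ʳ e)
  coveredSum-∷ʳ f prev e = trans (sym (∑-+ xs _ _)) (∑-cong xs pointwise)
    where
    pointwise : ∀ x → (if isNew prev e x then f x else 0) + (if coveredBy prev x then f x else 0)
                      ≡ (if coveredBy (prev ∷ʳ e) x then f x else 0)
    pointwise x rewrite coveredBy-∷ʳ prev e x = if-∧-not+if≡if-∨ (x ∈ₑ e) (coveredBy prev x) (f x)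

  residualSums-++ : ∀ f prev L →
    ∑ (allFin (length L)) (λ q → residualSum f (prev ++ take (toℕ q) L) (lookup L q)) + coveredSum f prev
    ≡ coveredSum f (prev ++ L)
  residualSums-++ f prev []      = cong (coveredSum f) (sym (++-identityʳ prev))
  residualSums-++ f prev (e ∷ L) = begin
    ∑ (allFin (suc (length L))) (λ q → residualSum f (prev ++ take (toℕ q) (e ∷ L)) (lookup (e ∷ L) q))
      + coveredSum f prev
      ≡⟨ cong (_+ coveredSum f prev)
           (∑-allFin-suc (λ q → residualSum f (prev ++ take (toℕ q) (e ∷ L)) (lookup (e ∷ L) q))) ⟩
    residualSum f (prev ++ []) e + rest + coveredSum f prev
      ≡⟨ cong₂ (λ p r → residualSum f p e + r + coveredSum f prev) (++-identityʳ prev) rest≡ ⟩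
    residualSum f prev e + rest′ + coveredSum f prev
      ≡⟨ xy∙z≈y∙xz +-commutativeSemigroup (residualSum f prev e) rest′ (coveredSum f prev) ⟩
    rest′ + (residualSum f prev e + coveredSum f prev)
      ≡⟨ cong (rest′ +_) (coveredSum-∷ʳ f prev e) ⟩
    rest′ + coveredSum f (prev ∷ʳ e)
      ≡⟨ residualSums-++ f (prev ∷ʳ e) L ⟩
    coveredSum f ((prev ∷ʳ e) ++ L)
      ≡⟨ cong (coveredSum f) (++-assoc prev (e ∷ []) L) ⟩
    coveredSum f (prev ++ e ∷ L)
      ∎
    where
    open ≡-Reasoning
    rest rest′ : ℕ
    rest  = ∑ (allFin (length L)) (λ q → residualSum f (prev ++ e ∷ take (toℕ q) L) (lookup L q))
    rest′ = ∑ (allFin (length L)) (λ q → residualSum f ((prev ∷ʳ e) ++ take (toℕ q) L) (lookup L q))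
    rest≡ : rest ≡ rest′
    rest≡ = ∑-cong (allFin (length L))
      (λ q → cong (λ p → residualSum f p (lookup L q)) (sym (++-assoc prev (e ∷ []) (take (toℕ q) L))))

  residualAt : (X → ℕ) → (L : List E) → Fin (length L) → ℕ
  residualAt f L q = residualSum f (take (toℕ q) L) (lookup L q)

  residualSums≡coveredSum : ∀ f L → ∑ (allFin (length L)) (residualAt f L) ≡ coveredSum f L
  residualSums≡coveredSum f L = begin
    Σq                    ≡⟨ +-identityʳ Σq ⟨
    Σq + 0                ≡⟨ cong (Σq +_) (∑-zero xs) ⟨
    Σq + coveredSum f []  ≡⟨ residualSums-++ f [] L ⟩
    coveredSum f L        ∎
    where
    open ≡-Reasoning
    Σq = ∑ (allFin (length L)) (residualAt f L)

module _ {m n : ℕ} where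

  ∑-allElems : ∀ g → ∑ (allElems m n) g ≡
    ∑ (allFin (3 * m)) (g ∘ α) + ∑ (allFin m) (λ i → ∑ (allFin n) (λ j → g (ω i j) + (g (τ i j) + 0)))
  ∑-allElems g = trans (∑-++ (map α (allFin (3 * m))) _ g)
    (cong₂ _+_ (∑-map α (allFin (3 * m)) g)
               (trans (∑-concatMap _ (allFin m) g) (∑-cong (allFin m) (λ i → ∑-concatMap _ (allFin n) g))))

  ω∈allElems : ∀ i j → ω i j ∈ allElems m n
  ω∈allElems i j = ∈-++⁺ʳ (map α (allFin (3 * m)))
    (∈-concatMap⁺ _ (lose (∈-allFin i) (∈-concatMap⁺ _ (lose (∈-allFin j) (here refl)))))

  τ∈allElems : ∀ i j → τ i j ∈ allElems m n
  τ∈allElems i j = ∈-++⁺ʳ (map α (allFin (3 * m)))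
    (∈-concatMap⁺ _ (lose (∈-allFin i) (∈-concatMap⁺ _ (lose (∈-allFin j) (there (here refl))))))

≟∧≟⇒≡ : ∀ {k l} {i i′ : Fin k} {j j′ : Fin l} → T (⌊ i ≟ i′ ⌋ ∧ ⌊ j ≟ j′ ⌋) → i ≡ i′ × j ≡ j′
≟∧≟⇒≡ {i = i} {i′} {j = j} {j′} i,j with to (T-∧ {⌊ i ≟ i′ ⌋} {⌊ j ≟ j′ ⌋}) i,j
... | i≡ , j≡ = toWitness i≡ , toWitness j≡

≟∧≟-refl : ∀ {k l} (i : Fin k) (j : Fin l) → T (⌊ i ≟ i ⌋ ∧ ⌊ j ≟ j ⌋)
≟∧≟-refl i j = from (T-∧ {⌊ i ≟ i ⌋} {⌊ j ≟ j ⌋}) (fromWitness refl , fromWitness refl)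

module Reduction (m : ℕ) (a : Fin (3 * m) → ℕ) (B : ℕ) (n : ℕ) (X : Fin n → Subset (3 * m)) where
  open Construction m a B n X
  open Residuals _∈ᵉ_ (allElems m n)

  ω∈assign : ∀ i j → T (ω i j ∈ᵉ assign i j)
  ω∈assign = ≟∧≟-refl

  τ∈assign : ∀ i j → T (τ i j ∈ᵉ assign i j)
  τ∈assign = ≟∧≟-refl

  ω∈⇒opening⊎assign : ∀ {i j} e → T (ω i j ∈ᵉ e) → e ≡ opening i j ⊎ e ≡ assign i j
  ω∈⇒opening⊎assign {i} {j} (opening i′ j′) ω∈ with ≟∧≟⇒≡ {i = i} {i′} {j = j} {j′} ω∈
  ... | refl , refl = inj₁ refl
  ω∈⇒opening⊎assign {i} {j} (assign i′ j′)  ω∈ with ≟∧≟⇒≡ {i = i} {i′} {j = j} {j′} ω∈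
  ... | refl , refl = inj₂ refl

  τ∈⇒≡assign : ∀ {i j} e → T (τ i j ∈ᵉ e) → e ≡ assign i j
  τ∈⇒≡assign {i} {j} (assign i′ j′) τ∈ with ≟∧≟⇒≡ {i = i} {i′} {j = j} {j′} τ∈
  ... | refl , refl = refl

  τ-covered⇒covered : ∀ L {i j} x → T (x ∈ᵉ assign i j) → T (coveredBy L (τ i j)) → T (coveredBy L x)
  τ-covered⇒covered L {i} {j} x x∈ =
    coveredBy-mono L (τ i j) x (λ e τ∈e → subst (λ e → T (x ∈ᵉ e)) (sym (τ∈⇒≡assign e τ∈e)) x∈)

  #ω #τ αWeight : Elem m n → ℕ
  #ω (ω _ _) = 1
  #ω _       = 0
  #τ (τ _ _) = 1
  #τ _       = 0
  αWeight (α ℓ) = a ℓ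
  αWeight _     = 0

  sumFin-a≤coveredSum : ∀ E′ → IsCovering E′ → sumFin a ≤ coveredSum αWeight E′
  sumFin-a≤coveredSum E′ cov = begin
    sumFin a                                           ≡⟨ ∑-cong (allFin (3 * m)) covered-a ⟩
    ∑ (allFin (3 * m)) (λ ℓ → if coveredBy E′ (α ℓ) then a ℓ else 0)
                                                       ≤⟨ m≤m+n _ _ ⟩
    _                                                  ≡⟨ ∑-allElems {m} {n} _ ⟨
    coveredSum αWeight E′                              ∎
    where
    open ≤-Reasoning
    covered-a : ∀ ℓ → a ℓ ≡ (if coveredBy E′ (α ℓ) then a ℓ else 0)
    covered-a ℓ rewrite to T-≡ (cov ℓ) = refl

  coveredSum-#τ≤#ω : ∀ L → coveredSum #τ L ≤ coveredSum #ω L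
  coveredSum-#τ≤#ω L = begin
    coveredSum #τ L  ≡⟨ ∑-allElems {m} {n} _ ⟩
    _                ≤⟨ +-monoʳ-≤ _ (∑-mono-≤ (allFin m) (λ i → ∑-mono-≤ (allFin n) (block i))) ⟩
    _                ≡⟨ ∑-allElems {m} {n} _ ⟨
    coveredSum #ω L  ∎
    where
    open ≤-Reasoning
    block : ∀ i j → (if coveredBy L (ω i j) then 0 else 0) + ((if coveredBy L (τ i j) then 1 else 0) + 0)
                  ≤ (if coveredBy L (ω i j) then 1 else 0) + ((if coveredBy L (τ i j) then 0 else 0) + 0)
    block i j with coveredBy L (ω i j) in ω-cov | coveredBy L (τ i j) in τ-cov
    ... | true  | true  = ≤-refl
    ... | true  | false = z≤n
    ... | false | false = z≤n
    ... | false | true  = ⊥-elim (subst T ω-cov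
      (τ-covered⇒covered L (ω i j) (ω∈assign i j) (subst T (sym τ-cov) tt)))

  αWeight∩X : Fin n → Elem m n → ℕ
  αWeight∩X j (α ℓ) = if Vec.lookup (X j) ℓ then a ℓ else 0
  αWeight∩X j _     = 0

  ∑-αWeight∩X : ∀ j → ∑ (allElems m n) (αWeight∩X j) ≡ subsetWeight a (X j)
  ∑-αWeight∩X j = begin
    ∑ (allElems m n) (αWeight∩X j)                                      ≡⟨ ∑-allElems {m} {n} (αWeight∩X j) ⟩
    subsetWeight a (X j) + ∑ (allFin m) (λ _ → ∑ (allFin n) (λ _ → 0))  ≡⟨ cong (subsetWeight a (X j) +_) zeros ⟩
    subsetWeight a (X j) + 0                                            ≡⟨ +-identityʳ _ ⟩
    subsetWeight a (X j)                                                ∎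
    where
    open ≡-Reasoning
    zeros : ∑ (allFin m) (λ _ → ∑ (allFin n) (λ _ → 0)) ≡ 0
    zeros = trans (∑-cong (allFin m) (λ _ → ∑-zero (allFin n))) (∑-zero (allFin m))

  residualSum-αWeight≤ : (∀ j → subsetWeight a (X j) ≤ B) →
                         ∀ prev e → residualSum αWeight prev e ≤ B * residualSum #τ prev e
  residualSum-αWeight≤ X≤B prev (opening i j) =
    ≤-trans (≤-reflexive (residualSum-≡0 αWeight prev (opening i j) only-ω)) z≤n
    where
    only-ω : ∀ x → T (isNew prev (opening i j) x) → αWeight x ≡ 0
    only-ω (ω _ _) _ = refl
  residualSum-αWeight≤ X≤B prev (assign i j) with T? (coveredBy prev (τ i j))
  ... | yes τ-covered = ≤-trans (≤-reflexive (residualSum-≡0 αWeight prev (assign i j) nothing-new)) z≤n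
    where
    nothing-new : ∀ x → T (isNew prev (assign i j) x) → αWeight x ≡ 0
    nothing-new x new =
      contradiction (τ-covered⇒covered prev x (isNew⇒∈ prev (assign i j) x new) τ-covered)
                    (isNew⇒¬covered prev (assign i j) x new)
  ... | no τ-fresh = begin
    residualSum αWeight prev (assign i j)  ≤⟨ residualSum-≤-∑ αWeight (αWeight∩X j) prev (assign i j) αWeight≤αWeight∩X ⟩
    ∑ (allElems m n) (αWeight∩X j)         ≡⟨ ∑-αWeight∩X j ⟩
    subsetWeight a (X j)                   ≤⟨ X≤B j ⟩
    B                                      ≡⟨ *-identityʳ B ⟨
    B * 1                                  ≤⟨ *-monoʳ-≤ B τ-new ⟩
    B * residualSum #τ prev (assign i j)   ∎
    where
    open ≤-Reasoning
    αWeight≤αWeight∩X : ∀ x → T (isNew prev (assign i j) x) → αWeight x ≤ αWeight∩X j x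
    αWeight≤αWeight∩X (α ℓ)   new
      rewrite to (T-≡ {Vec.lookup (X j) ℓ}) (isNew⇒∈ prev (assign i j) (α ℓ) new) = ≤-refl
    αWeight≤αWeight∩X (ω _ _) _ = z≤n
    αWeight≤αWeight∩X (τ _ _) _ = z≤n
    τ-new : 1 ≤ residualSum #τ prev (assign i j)
    τ-new = new⇒≤residualSum #τ prev (assign i j) (τ∈allElems i j)
      (isNew⁺ prev (assign i j) (τ i j) (τ∈assign i j) τ-fresh)

  m≤coveredSum-#τ : 0 < B → sumFin a ≡ m * B → (∀ j → subsetWeight a (X j) ≤ B) →
                    ∀ E′ → IsCovering E′ → m ≤ coveredSum #τ E′
  m≤coveredSum-#τ B>0 Σa≡mB X≤B E′ cov = *-cancelˡ-≤ B {{>-nonZero B>0}} (begin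
    B * m                                    ≡⟨ *-comm B m ⟩
    m * B                                    ≡⟨ Σa≡mB ⟨
    sumFin a                                 ≤⟨ sumFin-a≤coveredSum E′ cov ⟩
    coveredSum αWeight E′                    ≡⟨ residualSums≡coveredSum αWeight E′ ⟨
    ∑ qs (residualAt αWeight E′)             ≤⟨ ∑-mono-≤ qs (λ q → residualSum-αWeight≤ X≤B (before E′ q) (at E′ q)) ⟩
    ∑ qs (λ q → B * residualAt #τ E′ q)      ≡⟨ ∑-* qs B (residualAt #τ E′) ⟩
    B * ∑ qs (residualAt #τ E′)              ≡⟨ cong (B *_) (residualSums≡coveredSum #τ E′) ⟩
    B * coveredSum #τ E′                     ∎)
    where
    open ≤-Reasoning
    qs = allFin (length E′)

  2^≤partialCost : ∀ {u} → 0 < u → 2 ^ u ≤ partialCost u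
  2^≤partialCost {suc u} _ = ≤-refl

  2^W*k≤partialCost : ∀ {W u} → 0 < W → ∀ k → k * W ≤ u → 2 ^ W * k ≤ partialCost u
  2^W*k≤partialCost {W} W>0 zero    _     = ≤-trans (≤-reflexive (*-zeroʳ (2 ^ W))) z≤n
  2^W*k≤partialCost {W} {u} W>0 (suc k) kW≤u = begin
    2 ^ W * suc k       ≤⟨ 2^m*n≤2^[n*m] W>0 (suc k) ⟩
    2 ^ (suc k * W)     ≤⟨ ^-monoʳ-≤ 2 kW≤u ⟩
    2 ^ u               ≤⟨ 2^≤partialCost (<-≤-trans W>0 (≤-trans (m≤m+n W (k * W)) kW≤u)) ⟩
    partialCost u       ∎
    where open ≤-Reasoning

  2^W*k+2^W≤partialCost : ∀ {W u k} → 0 < W → 0 < k → k * W < u → 2 ^ W * k + 2 ^ W ≤ partialCost u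
  2^W*k+2^W≤partialCost {W} {u} {k} W>0 k>0 kW<u = begin
    2 ^ W * k + 2 ^ W                  ≤⟨ +-monoʳ-≤ (2 ^ W * k) (m≤m*n (2 ^ W) k {{>-nonZero k>0}}) ⟩
    2 ^ W * k + 2 ^ W * k              ≤⟨ +-mono-≤ (2^m*n≤2^[n*m] W>0 k) (2^m*n≤2^[n*m] W>0 k) ⟩
    2 ^ (k * W) + 2 ^ (k * W)          ≡⟨ cong (2 ^ (k * W) +_) (+-identityʳ (2 ^ (k * W))) ⟨
    2 ^ suc (k * W)                    ≤⟨ ^-monoʳ-≤ 2 kW<u ⟩
    2 ^ u                              ≤⟨ 2^≤partialCost (<-≤-trans (s≤s z≤n) kW<u) ⟩
    partialCost u                      ∎
    where open ≤-Reasoning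

  w>0 : 0 < w
  w>0 = m≤n+m 1 (t + B + ⌈log₂ m ⌉)

  #ω*w+#τ≤val : ∀ x → #ω x * w + #τ x ≤ val x
  #ω*w+#τ≤val (α ℓ)   = z≤n
  #ω*w+#τ≤val (ω i j) = ≤-reflexive (trans (+-identityʳ (w + 0)) (+-identityʳ w))
  #ω*w+#τ≤val (τ i j) = ≤-refl

  totalCost-≥ : ∀ E′ p → 0 < residualAt #ω E′ p → 0 < residualAt #τ E′ p →
                2 ^ w * coveredSum #ω E′ + 2 ^ w ≤ totalCost E′
  totalCost-≥ E′ p ω-new τ-new = begin
    2 ^ w * coveredSum #ω E′ + 2 ^ w                ≡⟨ cong (λ k → 2 ^ w * k + 2 ^ w) (residualSums≡coveredSum #ω E′) ⟨
    2 ^ w * ∑ qs (residualAt #ω E′) + 2 ^ w         ≡⟨ cong (_+ 2 ^ w) (∑-* qs (2 ^ w) (residualAt #ω E′)) ⟨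
    ∑ qs (λ q → 2 ^ w * residualAt #ω E′ q) + 2 ^ w ≤⟨ ∑-mono-≤-gap cost-≥ (∈-allFin p) cost-≥-at-p ⟩
    totalCost E′                                    ∎
    where
    open ≤-Reasoning
    qs = allFin (length E′)
    weight-≥ : ∀ q → residualAt #ω E′ q * w + residualAt #τ E′ q ≤ resWeight (before E′ q) (at E′ q)
    weight-≥ q = residualSum-affine-≤ #ω*w+#τ≤val (before E′ q) (at E′ q)
    cost-≥ : ∀ q → 2 ^ w * residualAt #ω E′ q ≤ partialCost (resWeight (before E′ q) (at E′ q))
    cost-≥ q = 2^W*k≤partialCost w>0 (residualAt #ω E′ q) (≤-trans (m≤m+n _ _) (weight-≥ q))
    cost-≥-at-p : 2 ^ w * residualAt #ω E′ p + 2 ^ w ≤ partialCost (resWeight (before E′ p) (at E′ p))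
    cost-≥-at-p = 2^W*k+2^W≤partialCost w>0 ω-new (<-≤-trans (m<m+n _ τ-new) (weight-≥ p))

  m*2^[t+B]<2^w : m * 2 ^ (t + B) < 2 ^ w
  m*2^[t+B]<2^w = begin-strict
    m * 2 ^ (t + B)                  ≤⟨ *-monoˡ-≤ (2 ^ (t + B)) (n≤2^⌈log₂n⌉ m) ⟩
    2 ^ ⌈log₂ m ⌉ * 2 ^ (t + B)      ≡⟨ *-comm (2 ^ ⌈log₂ m ⌉) (2 ^ (t + B)) ⟩
    2 ^ (t + B) * 2 ^ ⌈log₂ m ⌉      ≡⟨ ^-distribˡ-+-* 2 (t + B) ⌈log₂ m ⌉ ⟨
    2 ^ (t + B + ⌈log₂ m ⌉)          <⟨ ^-monoʳ-< 2 (s≤s (s≤s z≤n)) (m<m+n (t + B + ⌈log₂ m ⌉) (s≤s z≤n)) ⟩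
    2 ^ w                            ∎
    where open ≤-Reasoning

  budget<totalCost : Is3Partition m a B → IsEnumT m a B n X → ∀ E′ → IsCovering E′ →
                     ∀ p {i j} → at E′ p ≡ assign i j → ¬ T (coveredBy (before E′ p) (ω i j)) →
                     budget < totalCost E′
  budget<totalCost P TX E′ cov p {i} {j} at-p ω-fresh = begin-strict
    m * (2 ^ w + 2 ^ (t + B))          ≡⟨ *-distribˡ-+ m (2 ^ w) (2 ^ (t + B)) ⟩
    m * 2 ^ w + m * 2 ^ (t + B)        <⟨ +-monoʳ-< (m * 2 ^ w) m*2^[t+B]<2^w ⟩
    m * 2 ^ w + 2 ^ w                  ≡⟨ cong (_+ 2 ^ w) (*-comm m (2 ^ w)) ⟩
    2 ^ w * m + 2 ^ w                  ≤⟨ +-monoˡ-≤ (2 ^ w) (*-monoʳ-≤ (2 ^ w) m≤#ω) ⟩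
    2 ^ w * coveredSum #ω E′ + 2 ^ w   ≤⟨ totalCost-≥ E′ p (new-at-p (ω i j) (ω∈allElems i j) (ω∈assign i j) ω-fresh)
                                                         (new-at-p (τ i j) (τ∈allElems i j) (τ∈assign i j) τ-fresh) ⟩
    totalCost E′                       ∎
    where
    open ≤-Reasoning
    open Is3Partition P
    m≤#ω : m ≤ coveredSum #ω E′
    m≤#ω = ≤-trans (m≤coveredSum-#τ B-pos a-sum (≤-reflexive ∘ IsEnumT.X-weight TX) E′ cov) (coveredSum-#τ≤#ω E′)
    τ-fresh : ¬ T (coveredBy (before E′ p) (τ i j))
    τ-fresh = ω-fresh ∘ τ-covered⇒covered (before E′ p) (ω i j) (ω∈assign i j)
    new-at-p : ∀ {f} x → x ∈ allElems m n → T (x ∈ᵉ assign i j) → ¬ T (coveredBy (before E′ p) x) →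
               f x ≤ residualAt f E′ p
    new-at-p {f} x x∈ x∈assign fresh = new⇒≤residualSum f (before E′ p) (at E′ p) x∈
      (isNew⁺ (before E′ p) (at E′ p) x (subst (λ e → T (x ∈ᵉ e)) (sym at-p) x∈assign) fresh)

  opening-precedes : ∀ E′ p {i j} x → T (isNew (before E′ p) (assign i j) x) →
                     T (coveredBy (before E′ p) (ω i j)) →
                     Σ (Fin (length E′)) (λ q → toℕ q < toℕ p × at E′ q ≡ opening i j)
  opening-precedes E′ p {i} {j} x x-new ω-covered with coveredBy-take⁻ E′ (toℕ p) (ω i j) ω-covered
  ... | q , q<p , ω∈q with ω∈⇒opening⊎assign (at E′ q) ω∈q
  ...   | inj₁ at-q = q , q<p , at-q
  ...   | inj₂ at-q = contradiction
    (coveredBy-take⁺ E′ x q q<p (subst (λ e → T (x ∈ᵉ e)) (sym at-q) (isNew⇒∈ (before E′ p) (assign i j) x x-new)))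
    (isNew⇒¬covered (before E′ p) (assign i j) x x-new)

lemma1 : (m : ℕ) (a : Fin (3 * m) → ℕ) (B : ℕ) → Is3Partition m a B →
         (n : ℕ) (X : Fin n → Subset (3 * m)) → IsEnumT m a B n X →
         let open Construction m a B n X in
         (E′ : List (Edge m n)) → IsCovering E′ → totalCost E′ ≤ budget →
         (p : Fin (length E′)) (i : Fin m) (j : Fin n) →
         at E′ p ≡ assign i j →
         Σ (Elem m n) (λ x → T (inResidual (before E′ p) (assign i j) x)) →
         Σ (Fin (length E′)) (λ q → (toℕ q < toℕ p) × (at E′ q ≡ opening i j))
lemma1 m a B P n X TX E′ cov cost≤budget p i j at-p (x , x-new) =
  case T? (coveredBy (before E′ p) (ω i j)) of λ where
    (yes ω-covered) → opening-precedes E′ p x x-new ω-covered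
    (no ω-fresh)    → contradiction cost≤budget (<⇒≱ (budget<totalCost P TX E′ cov p at-p ω-fresh))
  where
  open Construction m a B n X
  open Residuals _∈ᵉ_ (allElems m n)
  open Reduction m a B n X
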